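{- Given a directed surface chemical reaction network (d-sCRN) $\Gamma=(Q,S,R)$, there exists a non-deterministic, fully asynchronous cellular automaton $\Gamma'=(Q',\mathcal{N},f)$ which simulates $\Gamma$.
   Context: A directed sCRN $\Gamma=(Q,S,R)$ lives on the square lattice $\mathbb{Z}^2$: each cell holds a species (state) from the finite set $Q$, $S$ is the initial configuration, and $R$ consists of unimolecular reactions $(A,B,\odot)$ (a cell in state $A$ may change to $B$) and bimolecular reactions $(A,B,C,D,d)$ with a global direction $d\in\{\uparrow,\rightarrow,\downarrow,\leftarrow\}$, meaning that if $B$ is the neighbor of $A$ in direction $d$ (North/East/South/West), the pair may simultaneously become $C$ (in place of $A$) and $D$ (in place of $B$). A non-deterministic asynchronous cellular automaton $\Gamma'=(Q',\mathcal{N},f)$ on $\mathbb{Z}^2$ has finite state set $Q'$, von Neumann neighborhood $\mathcal{N}=((0,0),(0,1),(1,0),(0,-1),(-1,0))$, and a non-deterministic local rule $f$ mapping the 5-tuple of states of a cell and its North, East, South, West neighbors to a set of possible next states; at each step a single cell is updated to one state chosen from $f$ of its neighborhood. For either system, $\alpha\to^1\beta$ denotes one-step reachability, $\to$ its reflexive-transitive closure, $\mathcal{A}(\cdot)$ the set of configurations reachable from the initial configuration, and $\mathcal{A}_*(\cdot)$ the reachable terminal configurations (for the CA: reachable fixed points of the global update). A state representation function $\mathcal{R}:Q'\to Q\cup\{\mathsf{UND}\}$ is applied cellwise to give $\mathcal{R}^*$ on configurations, with $\mathcal{R}^*(\alpha')=\mathsf{UND}$ if any cell maps to $\mathsf{UND}$.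 $\Gamma'$ simulates $\Gamma$ under $\mathcal{R}$ if: (equivalent productions) $\{\mathcal{R}^*(\alpha'):\alpha'\in\mathcal{A}(\Gamma')\}=\mathcal{A}(\Gamma)\cup\{\mathsf{UND}\}$ and $\{\mathcal{R}^*(\alpha'):\alpha'\in\mathcal{A}_*(\Gamma')\}=\mathcal{A}_*(\Gamma)$; (follows) $\alpha'\to_{\Gamma'}\beta'$ implies $\mathcal{R}^*(\alpha')\to_\Gamma\mathcal{R}^*(\beta')$ unless one of them is $\mathsf{UND}$; (models) for every $\alpha\in\mathcal{A}(\Gamma)$ there is a nonempty $\Pi\subseteq\mathcal{A}(\Gamma')$ with $\mathcal{R}^*(\alpha')=\alpha$ for all $\alpha'\in\Pi$ such that for every $\beta\in\mathcal{A}(\Gamma)$ with $\alpha\to\beta$: each $\alpha'\in\Pi$ reaches some $\beta'$ with $\mathcal{R}^*(\beta')=\beta$, and every $\alpha''\in\mathcal{A}(\Gamma')$ with $\mathcal{R}^*(\alpha'')=\alpha$ that reaches some $\beta'$ with $\mathcal{R}^*(\beta')=\beta$ is reachable from some $\alpha'\in\Pi$. -}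

module Defs where

open import Data.Nat using (ℕ)
open import Data.Integer using (ℤ; _+_; _-_; 1ℤ)
open import Data.Fin using (Fin)
open import Data.List using (List)
open import Data.List.Membership.Propositional using (_∈_)
open import Data.Maybe using (Maybe; just; nothing)
open import Data.Product using (Σ; ∃; _×_; _,_)
open import Data.Sum using (_⊎_)
open import Relation.Binary.PropositionalEquality using (_≡_; _≢_)
open import Relation.Nullary using (¬_)

Pos : Set
Pos = ℤ × ℤ

data Dir : Set where
  north east south west : Dir

move : Dir → Pos → Pos
move north (x , y) = (x , y + 1ℤ)
move east  (x , y) = (x + 1ℤ , y)
move south (x , y) = (x , y - 1ℤ)
move west  (x , y) = (x - 1ℤ , y)

Config : ℕ → Set
Config k = Pos → Fin k

_≈C_ : ∀ {k} → Config k → Config k → Set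
α ≈C β = ∀ p → α p ≡ β p

data Reach {k : ℕ} (step : Config k → Config k → Set) : Config k → Config k → Set where
  done : ∀ {α β} → α ≈C β → Reach step α β
  next : ∀ {α γ β} → step α γ → Reach step γ β → Reach step α β

data Reaction (n : ℕ) : Set where
  uni : (A B : Fin n) → Reaction n
  bi  : (A B C D : Fin n) → Dir → Reaction n

record DSCRN : Set where
  field
    n     : ℕ
    S     : Config n
    R     : List (Reaction n)
open DSCRN public

Apply : ∀ {n} → Reaction n → Pos → Config n → Config n → Set
Apply (uni A B) p α β =
  α p ≡ A × β p ≡ B × (∀ q → q ≢ p → β q ≡ α q)
Apply (bi A B C D d) p α β =
  α p ≡ A × α (move d p) ≡ B × β p ≡ C × β (move d p) ≡ D ×
  (∀ q → q ≢ p → q ≢ move d p → β q ≡ α q)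

Applicable : ∀ {n} → Reaction n → Pos → Config n → Set
Applicable (uni A B) p α = α p ≡ A
Applicable (bi A B C D d) p α = α p ≡ A × α (move d p) ≡ B

Step : (Γ : DSCRN) → Config (n Γ) → Config (n Γ) → Set
Step Γ α β = Σ (Reaction (n Γ)) λ ρ → ρ ∈ R Γ × Σ Pos λ p → Apply ρ p α β

_⊢_⟶_ : (Γ : DSCRN) → Config (n Γ) → Config (n Γ) → Set
Γ ⊢ α ⟶ β = Reach (Step Γ) α β

Terminal : (Γ : DSCRN) → Config (n Γ) → Set
Terminal Γ α = ¬ (Σ (Reaction (n Γ)) λ ρ → ρ ∈ R Γ × Σ Pos λ p → Applicable ρ p α)

Producible : (Γ : DSCRN) → Config (n Γ) → Set
Producible Γ α = Γ ⊢ S Γ ⟶ α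

TerminalProducible : (Γ : DSCRN) → Config (n Γ) → Set
TerminalProducible Γ α = Producible Γ α × Terminal Γ α

record NACA : Set where
  field
    m    : ℕ
    f    : Fin m → Fin m → Fin m → Fin m → Fin m → List (Fin m)
           -- f (self, North, East, South, West) = set of possible next states
    init : Config m
open NACA public

localRule : (Γ' : NACA) → Config (m Γ') → Pos → List (Fin (m Γ'))
localRule Γ' α p =
  f Γ' (α p) (α (move north p)) (α (move east p)) (α (move south p)) (α (move west p))

CAStep : (Γ' : NACA) → Config (m Γ') → Config (m Γ') → Set
CAStep Γ' α β = Σ Pos λ p → β p ∈ localRule Γ' α p × (∀ q → q ≢ p → β q ≡ α q)

_⊢ᶜ_⟶_ : (Γ' : NACA) → Config (m Γ') → Config (m Γ') → Set
Γ' ⊢ᶜ α ⟶ β = Reach (CAStep Γ') α β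

FixedPoint : (Γ' : NACA) → Config (m Γ') → Set
FixedPoint Γ' α = ∀ p q → q ∈ localRule Γ' α p → q ≡ α p

CAProducible : (Γ' : NACA) → Config (m Γ') → Set
CAProducible Γ' α = Γ' ⊢ᶜ init Γ' ⟶ α

CATerminalProducible : (Γ' : NACA) → Config (m Γ') → Set
CATerminalProducible Γ' α = CAProducible Γ' α × FixedPoint Γ' α

-- State representation functions (nothing = UND) and simulation

module _ (Γ : DSCRN) (Γ' : NACA) (ℛ : Fin (m Γ') → Maybe (Fin (n Γ))) where

  RepBy : Config (m Γ') → Config (n Γ) → Set
  RepBy α' α = ∀ p → ℛ (α' p) ≡ just (α p)

  IsUND : Config (m Γ') → Set
  IsUND α' = ∃ λ p → ℛ (α' p) ≡ nothing

  record EquivalentProductions : Set where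
    field
      prod-sound    : ∀ α' → CAProducible Γ' α' → ∀ α → RepBy α' α → Producible Γ α
      prod-complete : ∀ α → Producible Γ α → Σ (Config (m Γ')) λ α' → CAProducible Γ' α' × RepBy α' α
      und-produced  : Σ (Config (m Γ')) λ α' → CAProducible Γ' α' × IsUND α'
      term-sound    : ∀ α' → CATerminalProducible Γ' α' →
                        Σ (Config (n Γ)) λ α → RepBy α' α × TerminalProducible Γ α
      term-complete : ∀ α → TerminalProducible Γ α →
                        Σ (Config (m Γ')) λ α' → CATerminalProducible Γ' α' × RepBy α' α

  Follows : Set
  Follows = ∀ α' β' α β → Γ' ⊢ᶜ α' ⟶ β' → RepBy α' α → RepBy β' β → Γ ⊢ α ⟶ β

  Models : Set₁
  Models =
    ∀ α → Producible Γ α →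
    Σ (Config (m Γ') → Set) λ Π →
      (Σ (Config (m Γ')) Π) ×
      (∀ α' → Π α' → CAProducible Γ' α' × RepBy α' α) ×
      (∀ β → Producible Γ β → Γ ⊢ α ⟶ β →
         (∀ α' → Π α' → Σ (Config (m Γ')) λ β' → Γ' ⊢ᶜ α' ⟶ β' × RepBy β' β) ×
         (∀ α'' → CAProducible Γ' α'' → RepBy α'' α →
            (Σ (Config (m Γ')) λ β' → Γ' ⊢ᶜ α'' ⟶ β' × RepBy β' β) →
            Σ (Config (m Γ')) λ α' → Π α' × Γ' ⊢ᶜ α' ⟶ α''))

  record Simulates : Set₁ where
    field
      equivalent-productions : EquivalentProductions
      follows                : Follows
      models                 : Models

-- A cell of the automaton either holds a species X (stable X) or is in the middle of a reaction.
-- A unimolecular reaction A → B passes through pending B. A bimolecular reaction (A, B, C, D, d) is a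
-- handshake: the A-cell becomes an initiator, its d-neighbour B becomes the partner (the moment of
-- commitment), then the initiator resolves to C and finally the partner, once its initiator has left,
-- resolves to D; an initiator without a partner may fall back to A. Reading every cell as the species
-- it will settle to, each automaton step is either invisible or exactly one reaction of Γ (the
-- acceptance), which gives soundness; conversely a reaction of Γ is replayed by two or four steps between
-- all-stable configurations. A fixed point has no transient cell, since every transient cell can resolve
-- except a partner whose initiator is still attached, and that initiator can. So fixed points are
-- exactly the all-stable encodings of terminal configurations.

module Submission where

open import Defs
open import Data.Fin using (Fin)
open import Data.Maybe using (Maybe)
open import Data.Product using (Σ)

open import Algebra using (AbelianGroup)
open import Data.Empty using (⊥; ⊥-elim)
open import Data.Fin as Fin using (join; splitAt)
open import Data.Fin.Properties using (splitAt-join)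
open import Data.Integer as ℤ using (1ℤ; 0ℤ)
open import Data.Integer.Properties using (+-comm; i≢suc[i]; +-0-abelianGroup)
open import Data.List using (List; []; _∷_; _++_; map; concatMap; allFin; lookup; length)
open import Data.List.Membership.Propositional using (_∈_; lose)
open import Data.List.Membership.Propositional.Properties
  using (∈-lookup; ∈-map⁺; ∈-map⁻; ∈-++⁺ˡ; ∈-++⁺ʳ; ∈-++⁻; ∈-concatMap⁺; ∈-concatMap⁻; ∈-allFin)
open import Data.List.Relation.Unary.Any using (here; index; satisfied)
open import Data.List.Relation.Unary.Any.Properties using (lookup-index)
open import Data.Maybe using (just; nothing)
open import Data.Nat using (ℕ; _+_)
open import Data.Product using (_×_; _,_; proj₁; proj₂)
import Data.Product.Properties as Productₚ
open import Data.Sum using (_⊎_; inj₁; inj₂)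
import Data.Sum as Sum
import Data.Sum.Properties as Sumₚ
open import Data.Unit using (⊤; tt)
open import Function using (_∘_)
open import Function.Bundles using (_⇔_; mk⇔; Equivalence)
open import Function.Properties.Equivalence using () renaming (refl to ⇔-refl)
open import Relation.Binary.Definitions using (DecidableEquality)
open import Relation.Binary.PropositionalEquality
open import Relation.Nullary using (¬_; Dec; yes; no; ¬?; _×-dec_)

open import Algebra.Properties.Group (AbelianGroup.group +-0-abelianGroup)
  using (//-rightDividesˡ; //-rightDividesʳ)

opposite : Dir → Dir
opposite north = south
opposite east  = west
opposite south = north
opposite west  = east

opposite-involutive : ∀ d → opposite (opposite d) ≡ d
opposite-involutive north = refl
opposite-involutive east  = refl
opposite-involutive south = refl
opposite-involutive west  = refl

move-opposite-move : ∀ d p → move (opposite d) (move d p) ≡ p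
move-opposite-move north (x , y) = cong (x ,_) (//-rightDividesʳ 1ℤ y)
move-opposite-move east  (x , y) = cong (_, y) (//-rightDividesʳ 1ℤ x)
move-opposite-move south (x , y) = cong (x ,_) (//-rightDividesˡ 1ℤ y)
move-opposite-move west  (x , y) = cong (_, y) (//-rightDividesˡ 1ℤ x)

move-move-opposite : ∀ d p → move d (move (opposite d) p) ≡ p
move-move-opposite d p =
  subst (λ e → move e (move (opposite d) p) ≡ p) (opposite-involutive d) (move-opposite-move (opposite d) p)

move-injective : ∀ d {p q} → move d q ≡ p → q ≡ move (opposite d) p
move-injective d {q = q} eq = trans (sym (move-opposite-move d q)) (cong (move (opposite d)) eq)

move≢ : ∀ d p → move d p ≢ p
move≢ north (x , y) eq = i≢suc[i] (sym (trans (+-comm 1ℤ y) (cong proj₂ eq)))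
move≢ east  (x , y) eq = i≢suc[i] (sym (trans (+-comm 1ℤ x) (cong proj₁ eq)))
move≢ south p eq = move≢ north p (trans (cong (move north) (sym eq)) (move-opposite-move south p))
move≢ west  p eq = move≢ east  p (trans (cong (move east) (sym eq)) (move-opposite-move west p))

_≟Pos_ : DecidableEquality Pos
_≟Pos_ = Productₚ.≡-dec ℤ._≟_ ℤ._≟_

_[_≔_] : ∀ {k} → Config k → Pos → Fin k → Config k
(α [ p ≔ x ]) q with q ≟Pos p
... | yes _ = x
... | no _  = α q

update-≡ : ∀ {k} (α : Config k) p x → (α [ p ≔ x ]) p ≡ x
update-≡ α p x with p ≟Pos p
... | yes _  = refl
... | no p≢p = ⊥-elim (p≢p refl)

update-≢ : ∀ {k} (α : Config k) p x {q} → q ≢ p → (α [ p ≔ x ]) q ≡ α q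
update-≢ α p x {q} q≢p with q ≟Pos p
... | yes q≡p = ⊥-elim (q≢p q≡p)
... | no _    = refl

at-and-outside : ∀ {ℓ} (P : Pos → Set ℓ) p → P p → (∀ q → q ≢ p → P q) → ∀ q → P q
at-and-outside P p Pp Pq q with q ≟Pos p
... | yes refl = Pp
... | no q≢p   = Pq q q≢p

when : ∀ {a p} {A : Set a} {P : Set p} → Dec P → A → List A
when (yes _) x = x ∷ []
when (no _)  x = []

when⁺ : ∀ {a p} {A : Set a} {P : Set p} (P? : Dec P) {x : A} → P → x ∈ when P? x
when⁺ (yes _) _  = here refl
when⁺ (no ¬p) p = ⊥-elim (¬p p)

when⁻ : ∀ {a p} {A : Set a} {P : Set p} (P? : Dec P) {x y : A} → y ∈ when P? x → P × y ≡ x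
when⁻ (yes p) (here refl) = p , refl

module _ {k : ℕ} {step : Config k → Config k → Set}
         (step-respˡ : ∀ {α α′ γ} → α ≈C α′ → step α′ γ → step α γ) where

  Reach-respˡ : ∀ {α α′ β} → α ≈C α′ → Reach step α′ β → Reach step α β
  Reach-respˡ α≈α′ (done α′≈β) = done (λ p → trans (α≈α′ p) (α′≈β p))
  Reach-respˡ α≈α′ (next s r)  = next (step-respˡ α≈α′ s) r

  Reach-trans : ∀ {α β γ} → Reach step α β → Reach step β γ → Reach step α γ
  Reach-trans (done α≈β) r  = Reach-respˡ α≈β r
  Reach-trans (next s r) r′ = next s (Reach-trans r r′)

Reach-respʳ : ∀ {k} {step : Config k → Config k → Set} {α β β′} →
              Reach step α β → β ≈C β′ → Reach step α β′
Reach-respʳ (done α≈β) β≈β′ = done (λ p → trans (α≈β p) (β≈β′ p))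
Reach-respʳ (next s r) β≈β′ = next s (Reach-respʳ r β≈β′)

Step-respˡ : ∀ (Γ : DSCRN) {α α′ γ} → α ≈C α′ → Step Γ α′ γ → Step Γ α γ
Step-respˡ Γ α≈α′ (uni A B , ρ∈ , p , (αp , γp , frame)) =
  uni A B , ρ∈ , p , (trans (α≈α′ p) αp , γp , λ q q≢p → trans (frame q q≢p) (sym (α≈α′ q)))
Step-respˡ Γ α≈α′ (bi A B C D d , ρ∈ , p , (αp , αp′ , γp , γp′ , frame)) =
  bi A B C D d , ρ∈ , p ,
  (trans (α≈α′ p) αp , trans (α≈α′ (move d p)) αp′ , γp , γp′ ,
   λ q q≢p q≢p′ → trans (frame q q≢p q≢p′) (sym (α≈α′ q)))

localRule-cong : ∀ (Γ′ : NACA) {α α′} → α ≈C α′ → ∀ p → localRule Γ′ α p ≡ localRule Γ′ α′ p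
localRule-cong Γ′ α≈α′ p
  rewrite α≈α′ p | α≈α′ (move north p) | α≈α′ (move east p)
        | α≈α′ (move south p) | α≈α′ (move west p) = refl

CAStep-respˡ : ∀ (Γ′ : NACA) {α α′ γ} → α ≈C α′ → CAStep Γ′ α′ γ → CAStep Γ′ α γ
CAStep-respˡ Γ′ {γ = γ} α≈α′ (p , γp∈ , frame) =
  p , subst (γ p ∈_) (sym (localRule-cong Γ′ α≈α′ p)) γp∈ , λ q q≢p → trans (frame q q≢p) (sym (α≈α′ q))

module Construction (Γ : DSCRN) where

  N : ℕ
  N = n Γ

  r : ℕ
  r = length (R Γ)

  reaction : Fin r → Reaction N
  reaction = lookup (R Γ)

  reaction-∈ : ∀ {ρ} i → reaction i ≡ ρ → ρ ∈ R Γ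
  reaction-∈ i refl = ∈-lookup i

  reaction-index : ∀ {ρ} (ρ∈ : ρ ∈ R Γ) → reaction (index ρ∈) ≡ ρ
  reaction-index ρ∈ = sym (lookup-index ρ∈)

  State : Set
  State = (Fin N ⊎ Fin N) ⊎ (Fin r ⊎ Fin r)

  -- initiator i and partner i are the two cells of an ongoing bimolecular reaction number i.
  pattern stable X    = inj₁ (inj₁ X)
  pattern pending X   = inj₁ (inj₂ X)
  pattern initiator i = inj₂ (inj₁ i)
  pattern partner i   = inj₂ (inj₂ i)

  _≟S_ : DecidableEquality State
  _≟S_ = Sumₚ.≡-dec (Sumₚ.≡-dec Fin._≟_ Fin._≟_) (Sumₚ.≡-dec Fin._≟_ Fin._≟_)

  M : ℕ
  M = (N + N) + (r + r)

  encode : State → Fin M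
  encode s = join (N + N) (r + r) (Sum.map (join N N) (join r r) s)

  decode : Fin M → State
  decode x = Sum.map (splitAt N) (splitAt r) (splitAt (N + N) x)

  decode-encode : ∀ s → decode (encode s) ≡ s
  decode-encode s rewrite splitAt-join (N + N) (r + r) (Sum.map (join N N) (join r r) s) with s
  ... | inj₁ x = cong inj₁ (splitAt-join N N x)
  ... | inj₂ y = cong inj₂ (splitAt-join r r y)

  Neighbourhood : Set
  Neighbourhood = Dir → State

  Transient : State → Set
  Transient (stable _) = ⊥
  Transient _          = ⊤

  IsPartner : State → Set
  IsPartner (partner _) = ⊤
  IsPartner _           = ⊥

  PartnerLocked : Neighbourhood → Fin r → Reaction N → Set
  PartnerLocked nb i (uni A B)      = ⊥
  PartnerLocked nb i (bi A B C D d) = nb (opposite d) ≡ initiator i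

  Locked : State → Neighbourhood → Set
  Locked (partner i) nb = PartnerLocked nb i (reaction i)
  Locked _           nb = ⊥

  locked? : ∀ s nb → Dec (Locked s nb)
  locked? (stable _)    nb = no λ ()
  locked? (pending _)   nb = no λ ()
  locked? (initiator _) nb = no λ ()
  locked? (partner i)   nb with reaction i
  ... | uni A B      = no λ ()
  ... | bi A B C D d = nb (opposite d) ≟S initiator i

  -- settle s nb is the species a cell in state s stands for. An initiator or partner of a unimolecular
  -- reaction never occurs; its value A is arbitrary.
  initiatorOutcome : Neighbourhood → Fin r → Reaction N → Fin N
  initiatorOutcome nb i (uni A B)      = A
  initiatorOutcome nb i (bi A B C D d) with nb d ≟S partner i
  ... | yes _ = C
  ... | no _  = A

  partnerOutcome : Reaction N → Fin N
  partnerOutcome (uni A B)      = A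
  partnerOutcome (bi A B C D d) = D

  settle : State → Neighbourhood → Fin N
  settle (stable X)    nb = X
  settle (pending Y)   nb = Y
  settle (initiator i) nb = initiatorOutcome nb i (reaction i)
  settle (partner i)   nb = partnerOutcome (reaction i)

  data Transition (nb : Neighbourhood) : State → State → Set where
    unimolecular : ∀ {i A B} → reaction i ≡ uni A B → Transition nb (stable A) (pending B)
    initiate     : ∀ {i A B C D d} → reaction i ≡ bi A B C D d → nb d ≡ stable B →
                   Transition nb (stable A) (initiator i)
    accept       : ∀ {i A B C D d} → reaction i ≡ bi A B C D d → nb (opposite d) ≡ initiator i →
                   Transition nb (stable B) (partner i)
    resolve      : ∀ {s} → Transient s → ¬ Locked s nb → Transition nb s (stable (settle s nb))

  Transition-changes : ∀ {nb s t} → Transition nb s t → t ≢ s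
  Transition-changes (unimolecular _) ()
  Transition-changes (initiate _ _)   ()
  Transition-changes (accept _ _)     ()
  Transition-changes (resolve {pending _}   _ _) ()
  Transition-changes (resolve {initiator _} _ _) ()
  Transition-changes (resolve {partner _}   _ _) ()

  reactionMoves : Fin N → Neighbourhood → Fin r → Reaction N → List State
  reactionMoves X nb i (uni A B)      = when (A Fin.≟ X) (pending B)
  reactionMoves X nb i (bi A B C D d) =
    when (A Fin.≟ X ×-dec nb d ≟S stable B) (initiator i) ++
    when (B Fin.≟ X ×-dec nb (opposite d) ≟S initiator i) (partner i)

  transitions : State → Neighbourhood → List State
  transitions (stable X) nb = concatMap (λ i → reactionMoves X nb i (reaction i)) (allFin r)
  transitions s          nb = when (¬? (locked? s nb)) (stable (settle s nb))

  reactionMoves-sound : ∀ X nb i ρ → reaction i ≡ ρ → ∀ {t} → t ∈ reactionMoves X nb i ρ →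
                        Transition nb (stable X) t
  reactionMoves-sound X nb i (uni A B) e t∈ with when⁻ (A Fin.≟ X) t∈
  ... | refl , refl = unimolecular e
  reactionMoves-sound X nb i (bi A B C D d) e t∈
    with ∈-++⁻ (when (A Fin.≟ X ×-dec nb d ≟S stable B) (initiator i)) t∈
  ... | inj₁ t∈ˡ with when⁻ (A Fin.≟ X ×-dec nb d ≟S stable B) t∈ˡ
  ...   | (refl , nbB) , refl = initiate e nbB
  reactionMoves-sound X nb i (bi A B C D d) e t∈ | inj₂ t∈ʳ
    with when⁻ (B Fin.≟ X ×-dec nb (opposite d) ≟S initiator i) t∈ʳ
  ...   | (refl , nbI) , refl = accept e nbI

  transitions-sound : ∀ s nb {t} → t ∈ transitions s nb → Transition nb s t
  transitions-sound (stable X) nb t∈ with satisfied (∈-concatMap⁻ _ {xs = allFin r} t∈)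
  ... | i , t∈ᵢ = reactionMoves-sound X nb i (reaction i) refl t∈ᵢ
  transitions-sound s@(pending _) nb t∈ with when⁻ (¬? (locked? s nb)) t∈
  ... | unlocked , refl = resolve tt unlocked
  transitions-sound s@(initiator _) nb t∈ with when⁻ (¬? (locked? s nb)) t∈
  ... | unlocked , refl = resolve tt unlocked
  transitions-sound s@(partner _) nb t∈ with when⁻ (¬? (locked? s nb)) t∈
  ... | unlocked , refl = resolve tt unlocked

  reactionMoves⊆transitions : ∀ {X nb t} i → t ∈ reactionMoves X nb i (reaction i) →
                              t ∈ transitions (stable X) nb
  reactionMoves⊆transitions {X} {nb} i t∈ =
    ∈-concatMap⁺ (λ j → reactionMoves X nb j (reaction j)) (lose (∈-allFin i) t∈)

  transitions-complete : ∀ {nb s t} → Transition nb s t → t ∈ transitions s nb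
  transitions-complete {nb} (unimolecular {i} {A} {B} e) =
    reactionMoves⊆transitions i
      (subst (λ ρ → pending B ∈ reactionMoves A nb i ρ) (sym e) (when⁺ (A Fin.≟ A) refl))
  transitions-complete {nb} (initiate {i} {A} {B} {C} {D} {d} e nbB) =
    reactionMoves⊆transitions i
      (subst (λ ρ → initiator i ∈ reactionMoves A nb i ρ) (sym e)
        (∈-++⁺ˡ (when⁺ (A Fin.≟ A ×-dec nb d ≟S stable B) (refl , nbB))))
  transitions-complete {nb} (accept {i} {A} {B} {C} {D} {d} e nbI) =
    reactionMoves⊆transitions i
      (subst (λ ρ → partner i ∈ reactionMoves B nb i ρ) (sym e)
        (∈-++⁺ʳ _ (when⁺ (B Fin.≟ B ×-dec nb (opposite d) ≟S initiator i) (refl , nbI))))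
  transitions-complete {nb} (resolve {s@(pending _)}   _ unlocked) = when⁺ (¬? (locked? s nb)) unlocked
  transitions-complete {nb} (resolve {s@(initiator _)} _ unlocked) = when⁺ (¬? (locked? s nb)) unlocked
  transitions-complete {nb} (resolve {s@(partner _)}   _ unlocked) = when⁺ (¬? (locked? s nb)) unlocked

  decode-update-≡ : ∀ a p s → decode ((a [ p ≔ encode s ]) p) ≡ s
  decode-update-≡ a p s = trans (cong decode (update-≡ a p (encode s))) (decode-encode s)

  decode-update-≢ : ∀ {a p x q} → q ≢ p → decode ((a [ p ≔ x ]) q) ≡ decode (a q)
  decode-update-≢ {a} {p} {x} q≢p = cong decode (update-≢ a p x q≢p)

  decode-update-≢² : ∀ {a p p′ x y q} → q ≢ p → q ≢ p′ → decode (((a [ p ≔ x ]) [ p′ ≔ y ]) q) ≡ decode (a q)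
  decode-update-≢² q≢p q≢p′ = trans (decode-update-≢ q≢p′) (decode-update-≢ q≢p)

  origin : Pos
  origin = (0ℤ , 0ℤ)

  stableConfig : Config N → Config M
  stableConfig α q = encode (stable (α q))

  -- The pending cell makes an undefined configuration producible; it resolves at once to S.
  initial : Config M
  initial = stableConfig (S Γ) [ origin ≔ encode (pending (S Γ origin)) ]

  compass : State → State → State → State → Neighbourhood
  compass sN sE sS sW north = sN
  compass sN sE sS sW east  = sE
  compass sN sE sS sW south = sS
  compass sN sE sS sW west  = sW

  automaton : NACA
  automaton = record
    { m    = M
    ; f    = λ x xN xE xS xW →
               map encode (transitions (decode x) (compass (decode xN) (decode xE) (decode xS) (decode xW)))
    ; init = initial
    }

  neighbourhood : Config M → Pos → Neighbourhood
  neighbourhood a p =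
    compass (decode (a (move north p))) (decode (a (move east p)))
            (decode (a (move south p))) (decode (a (move west p)))

  neighbourhood-≡ : ∀ a p d → neighbourhood a p d ≡ decode (a (move d p))
  neighbourhood-≡ a p north = refl
  neighbourhood-≡ a p east  = refl
  neighbourhood-≡ a p south = refl
  neighbourhood-≡ a p west  = refl

  species : Config M → Config N
  species a q = settle (decode (a q)) (neighbourhood a q)

  species-at : ∀ a q {s} → decode (a q) ≡ s → species a q ≡ settle s (neighbourhood a q)
  species-at a q = cong (λ s → settle s (neighbourhood a q))

  initiatorOutcome-cong : ∀ {nb nb′} i ρ →
                          (∀ {A B C D d} → ρ ≡ bi A B C D d → nb d ≡ partner i ⇔ nb′ d ≡ partner i) →
                          initiatorOutcome nb i ρ ≡ initiatorOutcome nb′ i ρ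
  initiatorOutcome-cong i (uni A B) paired⇔ = refl
  initiatorOutcome-cong {nb} {nb′} i (bi A B C D d) paired⇔
    with nb d ≟S partner i | nb′ d ≟S partner i
  ... | yes _      | yes _       = refl
  ... | no _       | no _        = refl
  ... | yes paired | no unpaired = ⊥-elim (unpaired (Equivalence.to (paired⇔ refl) paired))
  ... | no unpaired | yes paired = ⊥-elim (unpaired (Equivalence.from (paired⇔ refl) paired))

  settle-cong : ∀ s {nb nb′} →
                (∀ {i A B C D d} → s ≡ initiator i → reaction i ≡ bi A B C D d →
                   nb d ≡ partner i ⇔ nb′ d ≡ partner i) →
                settle s nb ≡ settle s nb′
  settle-cong (stable _)    paired⇔ = refl
  settle-cong (pending _)   paired⇔ = refl
  settle-cong (initiator i) paired⇔ = initiatorOutcome-cong i (reaction i) (paired⇔ refl)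
  settle-cong (partner _)   paired⇔ = refl

  settle-initiator-unpaired : ∀ {nb i A B C D d} → reaction i ≡ bi A B C D d → nb d ≢ partner i →
                              settle (initiator i) nb ≡ A
  settle-initiator-unpaired {nb} {i} {d = d} e unpaired rewrite e with nb d ≟S partner i
  ... | yes paired = ⊥-elim (unpaired paired)
  ... | no _       = refl

  settle-initiator-paired : ∀ {nb i A B C D d} → reaction i ≡ bi A B C D d → nb d ≡ partner i →
                            settle (initiator i) nb ≡ C
  settle-initiator-paired {nb} {i} {d = d} e paired rewrite e with nb d ≟S partner i
  ... | yes _        = refl
  ... | no unpaired  = ⊥-elim (unpaired paired)

  settle-partner : ∀ {i A B C D d} → reaction i ≡ bi A B C D d → partnerOutcome (reaction i) ≡ D
  settle-partner e rewrite e = refl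

  species-cong : ∀ {a b} → a ≈C b → species a ≈C species b
  species-cong {a} {b} a≈b q rewrite a≈b q = settle-cong (decode (b q)) λ {_} {d = d} _ _ →
    subst (λ s → neighbourhood a q d ≡ _ ⇔ s ≡ _) (same-neighbour d) (⇔-refl)
    where
    same-neighbour : ∀ d → neighbourhood a q d ≡ neighbourhood b q d
    same-neighbour d =
      trans (neighbourhood-≡ a q d) (trans (cong decode (a≈b (move d q))) (sym (neighbourhood-≡ b q d)))

  UnchangedOutside : Pos → Config M → Config M → Set
  UnchangedOutside p a b = ∀ q → q ≢ p → b q ≡ a q

  -- The species of q depends on the cell p ≠ q only if q is an initiator pointing at p, and then
  -- only through whether p holds its partner.
  record PartnerPreserved (a b : Config M) (p q : Pos) : Set where
    constructor preserve
    field
      partner⇔ : ∀ {j A B C D d} → decode (a q) ≡ initiator j → reaction j ≡ bi A B C D d → move d q ≡ p →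
                 decode (a p) ≡ partner j ⇔ decode (b p) ≡ partner j

  species-frame : ∀ {a b p q} → UnchangedOutside p a b → q ≢ p → PartnerPreserved a b p q →
                  species a q ≡ species b q
  species-frame {a} {b} {p} {q} unchanged q≢p preserved rewrite unchanged q q≢p =
    settle-cong (decode (a q)) neighbour-paired⇔
    where
    neighbour-paired⇔ : ∀ {j A B C D d} → decode (a q) ≡ initiator j → reaction j ≡ bi A B C D d →
                        neighbourhood a q d ≡ partner j ⇔ neighbourhood b q d ≡ partner j
    neighbour-paired⇔ {d = d} aq e rewrite neighbourhood-≡ a q d | neighbourhood-≡ b q d
      with move d q ≟Pos p
    ... | yes watched rewrite watched = PartnerPreserved.partner⇔ preserved aq e watched
    ... | no unwatched rewrite unchanged (move d q) unwatched = ⇔-refl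

  species-unchanged : ∀ {a b p} → UnchangedOutside p a b → species a p ≡ species b p →
                      (∀ q → PartnerPreserved a b p q) → species a ≈C species b
  species-unchanged {a} {b} {p} unchanged same preserved =
    at-and-outside (λ q → species a q ≡ species b q) p same λ q q≢p → species-frame unchanged q≢p (preserved q)

  ≢partner : ∀ {x s j} → x ≡ s → ¬ IsPartner s → x ≢ partner j
  ≢partner refl notPartner refl = notPartner tt

  preserved-without-partner : ∀ {a b p s₀ s} → decode (a p) ≡ s₀ → decode (b p) ≡ s →
                              ¬ IsPartner s₀ → ¬ IsPartner s → ∀ q → PartnerPreserved a b p q
  preserved-without-partner ap bp s₀-no s-no q = preserve λ _ _ _ →
    mk⇔ (λ apj → ⊥-elim (≢partner ap s₀-no apj)) (λ bpj → ⊥-elim (≢partner bp s-no bpj))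

  watched-partner-locked : ∀ {a p q j A B C D d} → decode (a q) ≡ initiator j → reaction j ≡ bi A B C D d →
                           move d q ≡ p → decode (a p) ≡ partner j → Locked (decode (a p)) (neighbourhood a p)
  watched-partner-locked {a} {p} {j = j} {d = d} aq e watched ap rewrite ap =
    subst (PartnerLocked (neighbourhood a p) j) (sym e)
      (trans (neighbourhood-≡ a p (opposite d)) (trans (cong (decode ∘ a) (sym (move-injective d watched))) aq))

  preserved-unlocked : ∀ {a b p s₀ X} → decode (a p) ≡ s₀ → ¬ Locked s₀ (neighbourhood a p) →
                       decode (b p) ≡ stable X → ∀ q → PartnerPreserved a b p q
  preserved-unlocked {a} {p = p} ap unlocked bp q = preserve λ aq e watched →
    mk⇔ (λ apj → ⊥-elim (unlocked (subst (λ s → Locked s (neighbourhood a p)) ap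
                                     (watched-partner-locked {a} aq e watched apj))))
        (λ bpj → ⊥-elim (≢partner bp (λ ()) bpj))

  partner-injective : ∀ {i j} → _≡_ {A = State} (partner i) (partner j) → i ≡ j
  partner-injective refl = refl

  watcher-unique : ∀ {i p q A B C D d A′ B′ C′ D′ d′} → reaction i ≡ bi A B C D d →
                   reaction i ≡ bi A′ B′ C′ D′ d′ → move d′ q ≡ p → q ≡ move (opposite d) p
  watcher-unique e e′ watched with trans (sym e) e′
  ... | refl = move-injective _ watched

  preserved-accept : ∀ {a b p i A B C D d} → reaction i ≡ bi A B C D d →
                     decode (a p) ≡ stable B → decode (b p) ≡ partner i →
                     ∀ q → q ≢ move (opposite d) p → PartnerPreserved a b p q
  preserved-accept e ap bp q q≢initiator = preserve λ _ e′ watched →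
    mk⇔ (λ apj → ⊥-elim (≢partner ap (λ ()) apj))
        (λ bpj → ⊥-elim (q≢initiator (watcher-unique e
           (subst (λ k → reaction k ≡ _) (sym (partner-injective (trans (sym bp) bpj))) e′) watched)))

  transition-sound : ∀ {a b p s₀ s} → UnchangedOutside p a b → decode (a p) ≡ s₀ → decode (b p) ≡ s →
                     Transition (neighbourhood a p) s₀ s →
                     species a ≈C species b ⊎ Step Γ (species a) (species b)
  transition-sound {a} {b} {p} unchanged ap bp (unimolecular {i} {A} {B} e) =
    inj₂ (uni A B , reaction-∈ i e , p ,
          (species-at a p ap , species-at b p bp ,
           λ q q≢p → sym (species-frame unchanged q≢p (preserved-without-partner ap bp (λ ()) (λ ()) q))))
  transition-sound {a} {b} {p} unchanged ap bp (initiate {i} {A} {B} {C} {D} {d} e neighbourB) =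
    inj₁ (species-unchanged unchanged
            (trans (species-at a p ap) (sym (trans (species-at b p bp) (settle-initiator-unpaired e unpaired))))
            (preserved-without-partner ap bp (λ ()) (λ ())))
    where
    unpaired : neighbourhood b p d ≢ partner i
    unpaired = ≢partner (trans (neighbourhood-≡ b p d)
                          (trans (cong decode (unchanged (move d p) (move≢ d p)))
                            (trans (sym (neighbourhood-≡ a p d)) neighbourB)))
                        (λ ())
  transition-sound {a} {b} {p} unchanged ap bp (accept {i} {A} {B} {C} {D} {d} e neighbourI) =
    inj₂ (bi A B C D d , reaction-∈ i e , p′ ,
          (initiator-was-A , trans (cong (species a) p′→p) (species-at a p ap) ,
           initiator-now-C , trans (cong (species b) p′→p) (trans (species-at b p bp) (settle-partner e)) ,
           λ q q≢p′ q≢p → sym (species-frame unchanged (λ q≡p → q≢p (trans q≡p (sym p′→p)))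
                                 (preserved-accept e ap bp q q≢p′))))
    where
    p′ = move (opposite d) p
    p′→p : move d p′ ≡ p
    p′→p = move-move-opposite d p
    ap′ : decode (a p′) ≡ initiator i
    ap′ = trans (sym (neighbourhood-≡ a p (opposite d))) neighbourI
    bp′ : decode (b p′) ≡ initiator i
    bp′ = trans (cong decode (unchanged p′ (move≢ (opposite d) p))) ap′
    initiator-was-A : species a p′ ≡ A
    initiator-was-A = trans (species-at a p′ ap′) (settle-initiator-unpaired e
                    (≢partner (trans (neighbourhood-≡ a p′ d) (trans (cong (decode ∘ a) p′→p) ap)) (λ ())))
    initiator-now-C : species b p′ ≡ C
    initiator-now-C = trans (species-at b p′ bp′) (settle-initiator-paired e
                    (trans (neighbourhood-≡ b p′ d) (trans (cong (decode ∘ b) p′→p) bp)))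
  transition-sound {a} {b} {p} unchanged ap bp (resolve _ unlocked) =
    inj₁ (species-unchanged unchanged (trans (species-at a p ap) (sym (species-at b p bp)))
            (preserved-unlocked ap unlocked bp))

  CAStep-sound : ∀ {a b} → CAStep automaton a b → species a ≈C species b ⊎ Step Γ (species a) (species b)
  CAStep-sound {a} (p , bp∈ , unchanged) with ∈-map⁻ encode bp∈
  ... | s , s∈ , bp≡ =
    transition-sound unchanged refl (trans (cong decode bp≡) (decode-encode s))
      (transitions-sound (decode (a p)) (neighbourhood a p) s∈)

  species-reach : ∀ {a b} → automaton ⊢ᶜ a ⟶ b → Γ ⊢ species a ⟶ species b
  species-reach (done a≈b) = done (species-cong a≈b)
  species-reach (next s r) with CAStep-sound s
  ... | inj₁ same = Reach-respˡ (Step-respˡ Γ) same (species-reach r)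
  ... | inj₂ st   = next st (species-reach r)

  AllStable : Config M → Config N → Set
  AllStable a α = ∀ q → decode (a q) ≡ stable (α q)

  species-stable : ∀ {a α} → AllStable a α → species a ≈C α
  species-stable {a} stableα q = species-at a q (stableα q)

  Tracked : Config N → Config N → Set
  Tracked α β = ∀ {a} → AllStable a α → Σ (Config M) λ b → automaton ⊢ᶜ a ⟶ b × AllStable b β

  fire : ∀ a p {s₀ s} → decode (a p) ≡ s₀ → Transition (neighbourhood a p) s₀ s →
         CAStep automaton a (a [ p ≔ encode s ])
  fire a p {s = s} refl t =
    p ,
    subst (_∈ localRule automaton a p) (sym (update-≡ a p (encode s)))
      (∈-map⁺ encode (transitions-complete t)) ,
    λ q → update-≢ a p (encode s)

  simulate-unimolecular : ∀ {α β A B} → uni A B ∈ R Γ → ∀ p → Apply (uni A B) p α β → Tracked α β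
  simulate-unimolecular {α} {β} {A} {B} ρ∈ p (αp , βp , unchanged) {a} stableα =
    a₂ , next (fire a p (trans (stableα p) (cong stable αp)) (unimolecular (reaction-index ρ∈)))
           (next (fire a₁ p (decode-update-≡ a p (pending B)) (resolve tt λ ())) (done λ _ → refl)) ,
    stableβ
    where
    a₁ a₂ : Config M
    a₁ = a [ p ≔ encode (pending B) ]
    a₂ = a₁ [ p ≔ encode (stable B) ]
    stableβ : AllStable a₂ β
    stableβ = at-and-outside (λ q → decode (a₂ q) ≡ stable (β q)) p
      (trans (decode-update-≡ a₁ p (stable B)) (cong stable (sym βp)))
      λ q q≢p → trans (decode-update-≢² q≢p q≢p) (trans (stableα q) (cong stable (sym (unchanged q q≢p))))

  simulate-bimolecular : ∀ {α β A B C D d} → bi A B C D d ∈ R Γ → ∀ p → Apply (bi A B C D d) p α β →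
                         Tracked α β
  simulate-bimolecular {α} {β} {A} {B} {C} {D} {d} ρ∈ p (αp , αp′ , βp , βp′ , unchanged) {a} stableα =
    a₄ , next initiate-p (next accept-p′ (next resolve-p (next resolve-p′ (done λ _ → refl)))) , stableβ
    where
    i = index ρ∈
    e = reaction-index ρ∈
    p′ = move d p
    p′≢p : p′ ≢ p
    p′≢p = move≢ d p
    p′←p : move (opposite d) p′ ≡ p
    p′←p = move-opposite-move d p
    a₁ a₂ a₃ a₄ : Config M
    a₁ = a [ p ≔ encode (initiator i) ]
    a₂ = a₁ [ p′ ≔ encode (partner i) ]
    a₃ = a₂ [ p ≔ encode (stable C) ]
    a₄ = a₃ [ p′ ≔ encode (stable D) ]
    initiate-p : CAStep automaton a a₁
    initiate-p = fire a p (trans (stableα p) (cong stable αp))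
                   (initiate e (trans (neighbourhood-≡ a p d) (trans (stableα p′) (cong stable αp′))))
    accept-p′ : CAStep automaton a₁ a₂
    accept-p′ = fire a₁ p′ (trans (decode-update-≢ p′≢p) (trans (stableα p′) (cong stable αp′)))
                  (accept e (trans (neighbourhood-≡ a₁ p′ (opposite d))
                    (trans (cong (decode ∘ a₁) p′←p) (decode-update-≡ a p (initiator i)))))
    resolve-p : CAStep automaton a₂ a₃
    resolve-p = fire a₂ p (trans (decode-update-≢ (p′≢p ∘ sym)) (decode-update-≡ a p (initiator i)))
                  (subst (λ X → Transition (neighbourhood a₂ p) (initiator i) (stable X))
                     (settle-initiator-paired e
                        (trans (neighbourhood-≡ a₂ p d) (decode-update-≡ a₁ p′ (partner i))))
                     (resolve tt λ ()))
    unlocked : ¬ Locked (partner i) (neighbourhood a₃ p′)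
    unlocked locked with trans (sym (subst (PartnerLocked (neighbourhood a₃ p′) i) e locked))
                           (trans (neighbourhood-≡ a₃ p′ (opposite d))
                             (trans (cong (decode ∘ a₃) p′←p) (decode-update-≡ a₂ p (stable C))))
    ... | ()
    resolve-p′ : CAStep automaton a₃ a₄
    resolve-p′ = fire a₃ p′ (trans (decode-update-≢ p′≢p) (decode-update-≡ a₁ p′ (partner i)))
                   (subst (λ X → Transition (neighbourhood a₃ p′) (partner i) (stable X)) (settle-partner e)
                     (resolve tt unlocked))
    stableβ : AllStable a₄ β
    stableβ = at-and-outside (λ q → decode (a₄ q) ≡ stable (β q)) p′
      (trans (decode-update-≡ a₃ p′ (stable D)) (cong stable (sym βp′)))
      λ q q≢p′ → at-and-outside (λ q → q ≢ p′ → decode (a₄ q) ≡ stable (β q)) p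
        (λ p≢p′ → trans (decode-update-≢ p≢p′) (trans (decode-update-≡ a₂ p (stable C)) (cong stable (sym βp))))
        (λ q q≢p q≢p′ → trans (decode-update-≢² q≢p q≢p′) (trans (decode-update-≢² q≢p q≢p′)
                          (trans (stableα q) (cong stable (sym (unchanged q q≢p q≢p′))))))
        q q≢p′

  simulate-step : ∀ {α β} → Step Γ α β → Tracked α β
  simulate-step (uni A B , ρ∈ , p , applied)      = simulate-unimolecular ρ∈ p applied
  simulate-step (bi A B C D d , ρ∈ , p , applied) = simulate-bimolecular ρ∈ p applied

  simulate : ∀ {α β} → Γ ⊢ α ⟶ β → Tracked α β
  simulate (done α≈β) {a} stableα = a , done (λ _ → refl) , λ q → trans (stableα q) (cong stable (α≈β q))
  simulate (next step rest) stableα with simulate-step step stableα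
  ... | b , a⟶b , stableγ with simulate rest stableγ
  ...   | c , b⟶c , stableβ = c , Reach-trans (CAStep-respˡ automaton) a⟶b b⟶c , stableβ

  settled : Config M
  settled = initial [ origin ≔ encode (stable (S Γ origin)) ]

  decode-initial-≢ : ∀ {q} → q ≢ origin → decode (initial q) ≡ stable (S Γ q)
  decode-initial-≢ {q} q≢o = trans (decode-update-≢ q≢o) (decode-encode (stable (S Γ q)))

  initial-settles : automaton ⊢ᶜ initial ⟶ settled
  initial-settles =
    next (fire initial origin (decode-update-≡ (stableConfig (S Γ)) origin (pending (S Γ origin)))
               (resolve tt λ ()))
         (done λ _ → refl)

  settled-stable : AllStable settled (S Γ)
  settled-stable = at-and-outside (λ q → decode (settled q) ≡ stable (S Γ q)) origin
    (decode-update-≡ initial origin (stable (S Γ origin)))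
    λ q q≢o → trans (decode-update-≢ q≢o) (decode-initial-≢ q≢o)

  species-initial : S Γ ≈C species initial
  species-initial = at-and-outside (λ q → S Γ q ≡ species initial q) origin
    (sym (species-at initial origin (decode-update-≡ (stableConfig (S Γ)) origin (pending (S Γ origin)))))
    λ q q≢o → sym (species-at initial q (decode-initial-≢ q≢o))

  producible-tracked : ∀ α → Producible Γ α → Σ (Config M) λ a → CAProducible automaton a × AllStable a α
  producible-tracked α P with simulate P settled-stable
  ... | a , settled⟶a , stableα = a , Reach-trans (CAStep-respˡ automaton) initial-settles settled⟶a , stableα

  producible-species : ∀ a → CAProducible automaton a → Producible Γ (species a)
  producible-species a P = Reach-respˡ (Step-respˡ Γ) species-initial (species-reach P)

  fixed-immobile : ∀ {a} → FixedPoint automaton a → ∀ p {s₀ s} → decode (a p) ≡ s₀ →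
                   ¬ Transition (neighbourhood a p) s₀ s
  fixed-immobile {a} fixed p {s = s} refl t =
    Transition-changes t (trans (sym (decode-encode s))
      (cong decode (fixed p (encode s) (∈-map⁺ encode (transitions-complete t)))))

  fixed-partner-unlocked : ∀ {a} → FixedPoint automaton a → ∀ p i ρ → reaction i ≡ ρ →
                           ¬ PartnerLocked (neighbourhood a p) i ρ
  fixed-partner-unlocked fixed p i (uni A B) e ()
  fixed-partner-unlocked {a} fixed p i (bi A B C D d) e locked =
    fixed-immobile fixed (move (opposite d) p) (trans (sym (neighbourhood-≡ a p (opposite d))) locked)
      (resolve tt λ ())

  fixed-unlocked : ∀ {a} → FixedPoint automaton a → ∀ p s → ¬ Locked s (neighbourhood a p)
  fixed-unlocked fixed p (stable _)    ()
  fixed-unlocked fixed p (pending _)   ()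
  fixed-unlocked fixed p (initiator _) ()
  fixed-unlocked fixed p (partner i)   = fixed-partner-unlocked fixed p i (reaction i) refl

  fixed-stable : ∀ {a} → FixedPoint automaton a → AllStable a (species a)
  fixed-stable {a} fixed p = stable-at (decode (a p)) refl
    where
    stable-at : ∀ s → decode (a p) ≡ s → decode (a p) ≡ stable (species a p)
    stable-at (stable X)      ap = trans ap (cong stable (sym (species-at a p ap)))
    stable-at s@(pending _)   ap = ⊥-elim (fixed-immobile fixed p ap (resolve tt (fixed-unlocked fixed p s)))
    stable-at s@(initiator _) ap = ⊥-elim (fixed-immobile fixed p ap (resolve tt (fixed-unlocked fixed p s)))
    stable-at s@(partner _)   ap = ⊥-elim (fixed-immobile fixed p ap (resolve tt (fixed-unlocked fixed p s)))

  fixed-terminal : ∀ {a} → FixedPoint automaton a → Terminal Γ (species a)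
  fixed-terminal fixed (uni A B , ρ∈ , p , αp) =
    fixed-immobile fixed p (trans (fixed-stable fixed p) (cong stable αp)) (unimolecular (reaction-index ρ∈))
  fixed-terminal {a} fixed (bi A B C D d , ρ∈ , p , (αp , αp′)) =
    fixed-immobile fixed p (trans (fixed-stable fixed p) (cong stable αp))
      (initiate (reaction-index ρ∈)
        (trans (neighbourhood-≡ a p d) (trans (fixed-stable fixed (move d p)) (cong stable αp′))))

  stable-injective : ∀ {X Y} → _≡_ {A = State} (stable X) (stable Y) → X ≡ Y
  stable-injective refl = refl

  terminal-immobile : ∀ {a α} → AllStable a α → Terminal Γ α → ∀ p {s₀ s} → decode (a p) ≡ s₀ →
                      ¬ Transition (neighbourhood a p) s₀ s
  terminal-immobile stableα terminal p ap (unimolecular {i} e) =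
    terminal (_ , reaction-∈ i e , p , stable-injective (trans (sym (stableα p)) ap))
  terminal-immobile {a} stableα terminal p ap (initiate {i} {d = d} e neighbourB) =
    terminal (_ , reaction-∈ i e , p ,
              (stable-injective (trans (sym (stableα p)) ap) ,
               stable-injective (trans (sym (stableα (move d p)))
                                   (trans (sym (neighbourhood-≡ a p d)) neighbourB))))
  terminal-immobile {a} stableα terminal p ap (accept {d = d} e neighbourI)
    with trans (sym (trans (neighbourhood-≡ a p (opposite d)) (stableα _))) neighbourI
  ... | ()
  terminal-immobile stableα terminal p ap (resolve transient _) =
    subst Transient (trans (sym ap) (stableα p)) transient

  terminal-fixed : ∀ {a α} → AllStable a α → Terminal Γ α → FixedPoint automaton a
  terminal-fixed {a} stableα terminal p t t∈ with ∈-map⁻ encode t∈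
  ... | s , s∈ , _ = ⊥-elim (terminal-immobile stableα terminal p refl (transitions-sound _ _ s∈))

  stableSpecies : State → Maybe (Fin N)
  stableSpecies (stable X) = just X
  stableSpecies _          = nothing

  represent : Fin M → Maybe (Fin N)
  represent x = stableSpecies (decode x)

  stable-represents : ∀ {a α} → AllStable a α → RepBy Γ automaton represent a α
  stable-represents stableα q = cong stableSpecies (stableα q)

  stableSpecies-just : ∀ s {X} → stableSpecies s ≡ just X → s ≡ stable X
  stableSpecies-just (stable _) refl = refl

  represents-stable : ∀ {a α} → RepBy Γ automaton represent a α → AllStable a α
  represents-stable {a} rep q = stableSpecies-just (decode (a q)) (rep q)

  equivalent-productions : EquivalentProductions Γ automaton represent
  equivalent-productions = record
    { prod-sound    = λ a P α rep →
                        Reach-respʳ (producible-species a P) (species-stable (represents-stable rep))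
    ; prod-complete = λ α P → let a , Pa , stableα = producible-tracked α P in
                        a , Pa , stable-represents stableα
    ; und-produced  = initial , done (λ _ → refl) , origin ,
                      cong stableSpecies (decode-update-≡ (stableConfig (S Γ)) origin (pending (S Γ origin)))
    ; term-sound    = λ a (P , fixed) → species a , stable-represents (fixed-stable fixed) ,
                                        (producible-species a P , fixed-terminal fixed)
    ; term-complete = λ α (P , terminal) → let a , Pa , stableα = producible-tracked α P in
                        a , (Pa , terminal-fixed stableα terminal) , stable-represents stableα
    }

  follows : Follows Γ automaton represent
  follows a b α β a⟶b repα repβ =
    Reach-respˡ (Step-respˡ Γ) (λ q → sym (species-stable (represents-stable repα) q))
      (Reach-respʳ (species-reach a⟶b) (species-stable (represents-stable repβ)))

  models : Models Γ automaton represent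
  models α P =
    (λ a → CAProducible automaton a × RepBy Γ automaton represent a α) ,
    (let a , Pa , stableα = producible-tracked α P in a , Pa , stable-represents stableα) ,
    (λ _ inΠ → inΠ) ,
    λ β _ α⟶β →
      (λ a (_ , repα) → let b , a⟶b , stableβ = simulate α⟶β (represents-stable repα) in
                         b , a⟶b , stable-represents stableβ) ,
      λ a Pa repα _ → a , (Pa , repα) , done (λ _ → refl)

  simulation : Simulates Γ automaton represent
  simulation = record
    { equivalent-productions = equivalent-productions
    ; follows                = follows
    ; models                 = models
    }

theorem7 : (Γ : DSCRN) → Σ NACA λ Γ' → Σ (Fin (m Γ') → Maybe (Fin (n Γ))) λ ℛ → Simulates Γ Γ' ℛ
theorem7 Γ = automaton , represent , simulation
  where open Construction Γ
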